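{- For every complete $k$-partite graph $K_{r_1,\ldots,r_k}$ with $r_k\ge4$ we have $\chi_g(K_{r_1,\ldots,r_k})\ge 2k-1$.
   Context: Graph coloring game: given a graph $G$ and a finite set $C$ of colors, Alice and Bob alternately (Alice first) pick an uncolored vertex and give it a legal color, i.e. a color from $C$ not used on any neighbor. The game ends when all vertices are colored (Alice wins) or when no uncolored vertex has a legal color (Bob wins). The game chromatic number $\chi_g(G)$ is the minimum $|C|$ for which Alice has a winning strategy. $K_{r_1,\ldots,r_k}$ denotes the complete $k$-partite graph with parts (independent sets) $V_1,\ldots,V_k$, $|V_i|=r_i\ge1$, $r_1\ge\cdots\ge r_k$, every two vertices in different parts adjacent; the paper assumes that if $k\ge2$ then $r_1\ge 2$. -}

module Defs where

open import Data.Nat using (ℕ; _≤_; _<_; _∸_; _*_)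
open import Data.Fin using (Fin)
open import Data.Fin.Properties using () renaming (_≟_ to _≟ᶠ_)
open import Data.Product using (Σ; ∃; _×_; _,_; proj₁)
open import Data.Product.Properties using (≡-dec)
open import Data.Maybe using (Maybe; just; nothing; Is-just)
open import Relation.Nullary using (¬_; yes; no)
open import Relation.Binary using (DecidableEquality)
open import Relation.Binary.PropositionalEquality using (_≡_; _≢_)

record Graph : Set₁ where
  field
    V    : Set
    Adj  : V → V → Set
    _≟_  : DecidableEquality V

module Game (G : Graph) (c : ℕ) where
  open Graph G

  Colouring : Set
  Colouring = V → Maybe (Fin c)

  empty : Colouring
  empty _ = nothing

  AllColoured : Colouring → Set
  AllColoured σ = ∀ v → Is-just (σ v)

  Legal : Colouring → V → Fin c → Set
  Legal σ v a = (σ v ≡ nothing) × (∀ w → Adj v w → σ w ≢ just a)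

  update : Colouring → V → Fin c → Colouring
  update σ v a w with w ≟ v
  ... | yes _ = just a
  ... | no  _ = σ w

  data Player : Set where
    alice bob : Player

  -- AliceWins p σ : from position σ with player p to move, Alice can force
  -- the game to end with all vertices coloured.
  data AliceWins : Player → Colouring → Set where
    finished  : ∀ {p σ} → AllColoured σ → AliceWins p σ
    aliceMove : ∀ {σ} (v : V) (a : Fin c) → Legal σ v a →
                AliceWins bob (update σ v a) → AliceWins alice σ
    bobMove   : ∀ {σ} → ¬ AllColoured σ →
                -- the game has not ended: some legal move exists
                (∃ λ v → ∃ λ a → Legal σ v a) →
                (∀ v a → Legal σ v a → AliceWins alice (update σ v a)) →
                AliceWins bob σ

  AliceHasWinningStrategy : Set
  AliceHasWinningStrategy = AliceWins alice empty

GameChromatic≥ : Graph → ℕ → Set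
GameChromatic≥ G m = ∀ c → c < m → ¬ Game.AliceHasWinningStrategy G c

CompleteMultipartite : (k : ℕ) → (Fin k → ℕ) → Graph
CompleteMultipartite k r = record
  { V   = Σ (Fin k) (λ i → Fin (r i))
  ; Adj = λ u w → proj₁ u ≢ proj₁ w
  ; _≟_ = ≡-dec _≟ᶠ_ (λ {i} → _≟ᶠ_)
  }

-- Let t, u and n count the touched parts (those containing a coloured vertex), the colours in
-- use and the coloured vertices. Bob always plays a fresh colour: on an uncoloured vertex of a
-- touched part if there is one, and otherwise in an untouched part; in the latter case every
-- touched part is full, so 4t ≤ n as parts have at least four vertices. This keeps 2t ≤ u + 1
-- and n < 2u whenever Bob is to move. Once every colour is in use, an untouched part is blocked,
-- as each colour appears on a neighbour of its vertices; and not all k parts can be touched,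
-- since then 2k ≤ u + 1 ≤ c + 1 < 2k.
module Submission where

open import Defs
open import Data.Fin using (Fin; zero; suc; fromℕ<)
import Data.Fin.Properties as Fin
open import Data.Maybe using (Maybe; just; nothing; Is-just)
import Data.Maybe.Properties as Maybe
import Data.Maybe.Relation.Unary.Any as MaybeAny
open import Data.Nat using (ℕ; zero; suc; _+_; _*_; _∸_; _≤_; _<_; z≤n; s≤s; _<?_)
open import Data.Nat.Properties hiding (_≟_)
open import Algebra.Properties.Semiring.Sum +-*-semiring
  using (sum; *-distribˡ-sum; sum-cong-≗; sum-replicate-zero)
open import Data.Product using (∃; ∃₂; _×_; _,_; proj₁; proj₂)
open import Data.Sum using (_⊎_; inj₁; inj₂; [_,_]′)
open import Data.Unit using (tt)
open import Data.Vec.Functional using (Vector)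
open import Function using (_∘_; id)
open import Relation.Nullary using (¬_; Dec; yes; no; contradiction; ¬?; _×-dec_)
import Relation.Nullary.Decidable as Dec
open import Relation.Unary using (Pred; Decidable; _⊆_)
open import Relation.Binary.PropositionalEquality
  using (_≡_; _≢_; refl; sym; trans; cong; subst)

sum-mono-≤ : ∀ {n} {f g : Vector ℕ n} → (∀ i → f i ≤ g i) → sum f ≤ sum g
sum-mono-≤ {zero}  _   = z≤n
sum-mono-≤ {suc n} f≤g = +-mono-≤ (f≤g zero) (sum-mono-≤ (f≤g ∘ suc))

sum-mono-< : ∀ {n} {f g : Vector ℕ n} a → (∀ i → f i ≤ g i) → f a < g a → sum f < sum g
sum-mono-< zero    f≤g fa<ga = +-mono-<-≤ fa<ga (sum-mono-≤ (f≤g ∘ suc))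
sum-mono-< (suc a) f≤g fa<ga = +-mono-≤-< (f≤g zero) (sum-mono-< a (f≤g ∘ suc) fa<ga)

sum-≤-suc : ∀ {n} {f g : Vector ℕ n} a →
            (∀ i → i ≢ a → f i ≤ g i) → f a ≤ suc (g a) → sum f ≤ suc (sum g)
sum-≤-suc zero f≤g fa≤ = +-mono-≤ fa≤ (sum-mono-≤ λ i → f≤g (suc i) λ ())
sum-≤-suc {f = f} {g} (suc a) f≤g fa≤ = begin
  f zero + sum (f ∘ suc)       ≤⟨ +-mono-≤ (f≤g zero λ ()) (sum-≤-suc a f≤g∘suc fa≤) ⟩
  g zero + suc (sum (g ∘ suc)) ≡⟨ +-suc (g zero) _ ⟩
  suc (sum g)                  ∎
  where
  open ≤-Reasoning
  f≤g∘suc : ∀ i → i ≢ a → f (suc i) ≤ g (suc i)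
  f≤g∘suc i i≢a = f≤g (suc i) (i≢a ∘ Fin.suc-injective)

≤-sum : ∀ {n} (f : Vector ℕ n) i → f i ≤ sum f
≤-sum f zero    = m≤m+n _ _
≤-sum f (suc i) = ≤-trans (≤-sum (f ∘ suc) i) (m≤n+m _ _)

𝟙 : ∀ {p} {P : Set p} → Dec P → ℕ
𝟙 (yes _) = 1
𝟙 (no _)  = 0

𝟙≤1 : ∀ {p} {P : Set p} (P? : Dec P) → 𝟙 P? ≤ 1
𝟙≤1 (yes _) = s≤s z≤n
𝟙≤1 (no _)  = z≤n

1≤𝟙 : ∀ {p} {P : Set p} (P? : Dec P) → P → 1 ≤ 𝟙 P?
1≤𝟙 (yes _) _  = ≤-refl
1≤𝟙 (no ¬p) p = contradiction p ¬p

𝟙≡0 : ∀ {p} {P : Set p} (P? : Dec P) → ¬ P → 𝟙 P? ≡ 0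
𝟙≡0 (yes p) ¬p = contradiction p ¬p
𝟙≡0 (no _)  _  = refl

𝟙-mono : ∀ {p q} {P : Set p} {Q : Set q} → (P → Q) → (P? : Dec P) (Q? : Dec Q) → 𝟙 P? ≤ 𝟙 Q?
𝟙-mono P⇒Q (yes p) (yes _) = ≤-refl
𝟙-mono P⇒Q (yes p) (no ¬q) = contradiction (P⇒Q p) ¬q
𝟙-mono P⇒Q (no _)  _       = z≤n

count : ∀ {n p} {P : Pred (Fin n) p} → Decidable P → ℕ
count P? = sum (𝟙 ∘ P?)

module _ {n p} {P : Pred (Fin n) p} (P? : Decidable P) where

  count≤n : count P? ≤ n
  count≤n = sum-≤-ones (𝟙≤1 ∘ P?)
    where
    sum-≤-ones : ∀ {n} {f : Vector ℕ n} → (∀ i → f i ≤ 1) → sum f ≤ n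
    sum-≤-ones {zero}  _    = z≤n
    sum-≤-ones {suc n} f≤1 = +-mono-≤ (f≤1 zero) (sum-≤-ones (f≤1 ∘ suc))

  ∀⇒n≤count : (∀ i → P i) → n ≤ count P?
  ∀⇒n≤count all = ones-≤-sum λ i → 1≤𝟙 (P? i) (all i)
    where
    ones-≤-sum : ∀ {n} {f : Vector ℕ n} → (∀ i → 1 ≤ f i) → n ≤ sum f
    ones-≤-sum {zero}  _    = z≤n
    ones-≤-sum {suc n} 1≤f = +-mono-≤ (1≤f zero) (ones-≤-sum (1≤f ∘ suc))

  ∃⇒0<count : ∀ {a} → P a → 0 < count P?
  ∃⇒0<count {a} pa = ≤-trans (1≤𝟙 (P? a) pa) (≤-sum (𝟙 ∘ P?) a)

  ∄⇒count≡0 : (∀ i → ¬ P i) → count P? ≡ 0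
  ∄⇒count≡0 none = trans (sum-cong-≗ λ i → 𝟙≡0 (P? i) (none i)) (sum-replicate-zero n)

module _ {n p q} {P : Pred (Fin n) p} {Q : Pred (Fin n) q} (P? : Decidable P) (Q? : Decidable Q) where

  count-mono : P ⊆ Q → count P? ≤ count Q?
  count-mono P⊆Q = sum-mono-≤ λ i → 𝟙-mono P⊆Q (P? i) (Q? i)

  count-mono-< : P ⊆ Q → ∀ {a} → ¬ P a → Q a → count P? < count Q?
  count-mono-< P⊆Q {a} ¬pa qa = sum-mono-< a (λ i → 𝟙-mono P⊆Q (P? i) (Q? i)) (𝟙<𝟙 (P? a) (Q? a))
    where
    𝟙<𝟙 : (P? : Dec (P a)) (Q? : Dec (Q a)) → 𝟙 P? < 𝟙 Q?
    𝟙<𝟙 (yes pa) _        = contradiction pa ¬pa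
    𝟙<𝟙 (no _)   (yes _)  = s≤s z≤n
    𝟙<𝟙 (no _)   (no ¬qa) = contradiction qa ¬qa

  count-≤-suc : ∀ a → (∀ {i} → P i → Q i ⊎ i ≡ a) → count P? ≤ suc (count Q?)
  count-≤-suc a P⊆Q∪a = sum-≤-suc a 𝟙P≤𝟙Q (≤-trans (𝟙≤1 (P? a)) (s≤s z≤n))
    where
    𝟙P≤𝟙Q : ∀ i → i ≢ a → 𝟙 (P? i) ≤ 𝟙 (Q? i)
    𝟙P≤𝟙Q i i≢a = 𝟙-mono (λ pi → [ id , (λ i≡a → contradiction i≡a i≢a) ]′ (P⊆Q∪a pi)) (P? i) (Q? i)

∀⊎∃¬ : ∀ {n p} {P : Pred (Fin n) p} → Decidable P → (∀ i → P i) ⊎ ∃ λ i → ¬ P i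
∀⊎∃¬ {n} P? with Fin.all? P?
... | yes all = inj₁ all
... | no ¬all = inj₂ (Fin.¬∀⟶∃¬ n _ P? ¬all)

¬Is-just⇒≡nothing : ∀ {a} {A : Set a} {m : Maybe A} → ¬ Is-just m → m ≡ nothing
¬Is-just⇒≡nothing {m = nothing} _       = refl
¬Is-just⇒≡nothing {m = just _}  ¬just = contradiction (MaybeAny.just tt) ¬just

m<n∸1⇒2+m≤n : ∀ {m} n → m < n ∸ 1 → 2 + m ≤ n
m<n∸1⇒2+m≤n (suc n) m<n = s≤s m<n

-- The invariants on (t, u, n) with Alice, resp. Bob, to move; n ≡ 0 covers the initial position.
AliceBound BobBound : (t u n : ℕ) → Set
AliceBound t u n = 2 * t ≤ u × (n ≡ 0 ⊎ 2 + n ≤ 2 * u)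
BobBound   t u n = 2 * t ≤ suc u × suc n ≤ 2 * u

private
  coloured-bound-step : ∀ {n n' u u'} → n ≤ 2 * u → n' ≤ suc n → suc u ≤ u' → suc n' ≤ 2 * u'
  coloured-bound-step {n} {n'} {u} {u'} n≤2u n'≤ u<u' = begin
    suc n'      ≤⟨ s≤s n'≤ ⟩
    2 + n       ≤⟨ +-monoʳ-≤ 2 n≤2u ⟩
    2 + 2 * u   ≡⟨ *-suc 2 u ⟨
    2 * suc u   ≤⟨ *-monoʳ-≤ 2 u<u' ⟩
    2 * u'      ∎
    where open ≤-Reasoning

  touched-bound-step : ∀ {t t' u} → t' ≤ suc t → suc (2 * t) ≤ u → 2 * t' ≤ suc u
  touched-bound-step {t} {t'} {u} t'≤ 2t<u = begin
    2 * t'         ≤⟨ *-monoʳ-≤ 2 t'≤ ⟩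
    2 * suc t      ≡⟨ *-suc 2 t ⟩
    2 + 2 * t      ≤⟨ s≤s 2t<u ⟩
    suc u          ∎
    where open ≤-Reasoning

4t≤n<2u⇒2t<u : ∀ {t n u} → 4 * t ≤ n → suc n ≤ 2 * u → 2 * t < u
4t≤n<2u⇒2t<u {t} {n} {u} 4t≤n n<2u =
  *-cancelˡ-< 2 (2 * t) u (≤-<-trans (≤-trans (≤-reflexive (sym (*-assoc 2 2 t))) 4t≤n) n<2u)

aliceBound-newPart : ∀ {t u n t' u' n'} → AliceBound t u n →
                     t' ≤ suc t → suc u ≤ u' → n' ≤ suc n → BobBound t' u' n'
aliceBound-newPart {u = u} {n} (2t≤u , n-bound) t'≤ u<u' n'≤ =
  touched-bound-step t'≤ (≤-trans (s≤s 2t≤u) u<u') , coloured-bound-step n≤2u n'≤ u<u'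
  where
  n≤2u : n ≤ 2 * u
  n≤2u = [ (λ { refl → z≤n }) , ≤-trans (m≤n+m n 2) ]′ n-bound

aliceBound-oldPart : ∀ {t u n t' u' n'} → AliceBound t u n → 0 < n →
                     t' ≤ t → u ≤ u' → n' ≤ suc n → BobBound t' u' n'
aliceBound-oldPart (2t≤u , inj₁ refl)     ()  _    _    _
aliceBound-oldPart (2t≤u , inj₂ 2+n≤2u) _   t'≤t u≤u' n'≤ =
  ≤-trans (*-monoʳ-≤ 2 t'≤t) (≤-trans 2t≤u (≤-trans u≤u' (n≤1+n _))) ,
  ≤-trans (s≤s n'≤) (≤-trans 2+n≤2u (*-monoʳ-≤ 2 u≤u'))

bobBound-oldPart : ∀ {t u n t' u' n'} → BobBound t u n →
                   t' ≤ t → suc u ≤ u' → n' ≤ suc n → AliceBound t' u' n'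
bobBound-oldPart (2t≤1+u , n<2u) t'≤t u<u' n'≤ =
  ≤-trans (*-monoʳ-≤ 2 t'≤t) (≤-trans 2t≤1+u u<u') ,
  inj₂ (coloured-bound-step n<2u (s≤s n'≤) u<u')

bobBound-newPart : ∀ {t u n t' u' n'} → BobBound t u n → 4 * t ≤ n →
                   t' ≤ suc t → suc u ≤ u' → n' ≤ suc n → AliceBound t' u' n'
bobBound-newPart {t} (_ , n<2u) 4t≤n t'≤ u<u' n'≤ =
  ≤-trans (touched-bound-step t'≤ (4t≤n<2u⇒2t<u {t} 4t≤n n<2u)) u<u' ,
  inj₂ (coloured-bound-step n<2u (s≤s n'≤) u<u')

module GameProperties (G : Graph) (c : ℕ) where
  open Graph G
  open Game G c

  update-≡ : ∀ σ v a → update σ v a v ≡ just a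
  update-≡ σ v a with v ≟ v
  ... | yes _   = refl
  ... | no v≢v = contradiction refl v≢v

  update-≢ : ∀ σ {v w} a → w ≢ v → update σ v a w ≡ σ w
  update-≢ σ {v} {w} a w≢v with w ≟ v
  ... | yes w≡v = contradiction w≡v w≢v
  ... | no _    = refl

  module _ {σ : Colouring} {v : V} (free : σ v ≡ nothing) (a : Fin c) where

    update-keeps : ∀ {w b} → σ w ≡ just b → update σ v a w ≡ just b
    update-keeps {w} σw≡b = trans (update-≢ σ a w≢v) σw≡b
      where
      w≢v : w ≢ v
      w≢v refl with trans (sym σw≡b) free
      ... | ()

    update-Is-just : ∀ {w} → Is-just (update σ v a w) → Is-just (σ w) ⊎ w ≡ v
    update-Is-just {w} coloured with w ≟ v
    ... | yes w≡v = inj₂ w≡v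
    ... | no _    = inj₁ coloured

  Used : Colouring → Fin c → Set
  Used σ a = ∃ λ w → σ w ≡ just a

  used-update : ∀ {σ v b} → σ v ≡ nothing → ∀ a → Used σ b → Used (update σ v a) b
  used-update {σ} {v} free a (w , σw≡b) = w , update-keeps {σ} {v} free a σw≡b

  used-update-self : ∀ σ v a → Used (update σ v a) a
  used-update-self σ v a = v , update-≡ σ v a

  unused⇒legal : ∀ {σ v a} → σ v ≡ nothing → ¬ Used σ a → Legal σ v a
  unused⇒legal free unused = free , λ w _ σw≡a → unused (w , σw≡a)

  Blocked : Colouring → Set
  Blocked σ = ∃ λ v → σ v ≡ nothing × (∀ a → ∃ λ w → Adj v w × σ w ≡ just a)

  blocked-update : ∀ {σ w b} → Blocked σ → Legal σ w b → Blocked (update σ w b)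
  blocked-update {σ} {w} {b} (v , free , hit) (w-free , w-legal) with v ≟ w
  ... | yes refl = let (u , adj , σu≡b) = hit b in contradiction σu≡b (w-legal u adj)
  ... | no v≢w   = v , trans (update-≢ σ b v≢w) free ,
                   λ a → let (u , adj , σu≡a) = hit a in u , adj , update-keeps {σ} {w} w-free b σu≡a

  blocked⇒¬wins : ∀ {p σ} → Blocked σ → ¬ AliceWins p σ
  blocked⇒¬wins (v , free , _) (finished all) with subst Is-just free (all v)
  ... | ()
  blocked⇒¬wins blocked (aliceMove _ _ legal win)    = blocked⇒¬wins (blocked-update blocked legal) win
  blocked⇒¬wins blocked (bobMove _ (_ , _ , legal) next) =
    blocked⇒¬wins (blocked-update blocked legal) (next _ _ legal)

  CanMoveInto : (Colouring → Set) → Colouring → Set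
  CanMoveInto Inv σ = ∃₂ λ v a → Legal σ v a × Inv (update σ v a)

  module InvariantStrategy
    (AliceInv BobInv : Colouring → Set)
    (alice-ends : ∀ {σ} → AliceInv σ → ¬ AllColoured σ)
    (bob-ends   : ∀ {σ} → BobInv σ → ¬ AllColoured σ)
    (alice-move : ∀ {σ v a} → AliceInv σ → Legal σ v a → BobInv (update σ v a))
    (bob-reply  : ∀ {σ} → BobInv σ → Blocked σ ⊎ CanMoveInto AliceInv σ)
    where

    mutual
      alice-loses : ∀ {σ} → AliceInv σ → ¬ AliceWins alice σ
      alice-loses inv (finished all)          = alice-ends inv all
      alice-loses inv (aliceMove _ _ legal win) = bob-wins (alice-move inv legal) win

      bob-wins : ∀ {σ} → BobInv σ → ¬ AliceWins bob σ
      bob-wins inv (finished all) = bob-ends inv all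
      bob-wins inv win@(bobMove _ _ next) with bob-reply inv
      ... | inj₁ blocked                 = blocked⇒¬wins blocked win
      ... | inj₂ (v , a , legal , inv') = alice-loses inv' (next v a legal)

module Multipartite (k : ℕ) (r : Fin k → ℕ) (c : ℕ) where
  open Game (CompleteMultipartite k r) c
  open GameProperties (CompleteMultipartite k r) c

  is-just? : (m : Maybe (Fin c)) → Dec (Is-just m)
  is-just? = MaybeAny.dec (λ _ → yes tt)

  coloured? : (σ : Colouring) (i : Fin k) (j : Fin (r i)) → Dec (Is-just (σ (i , j)))
  coloured? σ i j = is-just? (σ (i , j))

  colouredIn : Colouring → Fin k → ℕ
  colouredIn σ i = count (coloured? σ i)

  coloured : Colouring → ℕ
  coloured σ = sum (colouredIn σ)

  Touched : Colouring → Fin k → Set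
  Touched σ i = 0 < colouredIn σ i

  touched? : (σ : Colouring) → Decidable (Touched σ)
  touched? σ i = 0 <? colouredIn σ i

  touched : Colouring → ℕ
  touched σ = count (touched? σ)

  used? : (σ : Colouring) → Decidable (Used σ)
  used? σ a = Dec.map′ (λ (i , j , e) → (i , j) , e) (λ ((i , j) , e) → i , j , e)
    (Fin.any? λ i → Fin.any? λ j → Maybe.≡-dec Fin._≟_ (σ (i , j)) (just a))

  used : Colouring → ℕ
  used σ = count (used? σ)

  coloured⇒touched : ∀ {σ : Colouring} {i j} → Is-just (σ (i , j)) → Touched σ i
  coloured⇒touched {σ} {i} = ∃⇒0<count (coloured? σ i)

  untouched⇒free : ∀ {σ : Colouring} {i} → ¬ Touched σ i → ∀ j → σ (i , j) ≡ nothing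
  untouched⇒free {σ} {i} untouched j = ¬Is-just⇒≡nothing (untouched ∘ coloured⇒touched {σ} {i} {j})

  untouched⇒colours-elsewhere : ∀ {σ : Colouring} {i i' j' a} →
                                ¬ Touched σ i → σ (i' , j') ≡ just a → i ≢ i'
  untouched⇒colours-elsewhere {σ} {j' = j'} untouched σi'j'≡a refl
    with trans (sym σi'j'≡a) (untouched⇒free {σ} untouched j')
  ... | ()

  colouredIn-empty : ∀ i → colouredIn empty i ≡ 0
  colouredIn-empty i = ∄⇒count≡0 (coloured? empty i) λ _ ()

  coloured-empty : coloured empty ≡ 0
  coloured-empty = trans (sum-cong-≗ colouredIn-empty) (sum-replicate-zero k)

  touched-empty : touched empty ≡ 0
  touched-empty = ∄⇒count≡0 (touched? empty) λ i t → n≮0 (≤-trans t (≤-reflexive (colouredIn-empty i)))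

  module _ {σ : Colouring} {i₀ : Fin k} {j₀ : Fin (r i₀)} (free : σ (i₀ , j₀) ≡ nothing) (a : Fin c) where
    private
      σ' : Colouring
      σ' = update σ (i₀ , j₀) a

    colouredIn-update-≢ : ∀ {i} → i ≢ i₀ → colouredIn σ' i ≤ colouredIn σ i
    colouredIn-update-≢ {i} i≢i₀ = count-mono (coloured? σ' i) (coloured? σ i) λ coloured' →
      [ id , (λ e → contradiction (cong proj₁ e) i≢i₀) ]′ (update-Is-just {σ} {i₀ , j₀} free a coloured')

    colouredIn-update-≡ : colouredIn σ' i₀ ≤ suc (colouredIn σ i₀)
    colouredIn-update-≡ = count-≤-suc (coloured? σ' i₀) (coloured? σ i₀) j₀ λ coloured' →
      [ inj₁ , (λ { refl → inj₂ refl }) ]′ (update-Is-just {σ} {i₀ , j₀} free a coloured')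

    coloured-update : coloured σ' ≤ suc (coloured σ)
    coloured-update = sum-≤-suc i₀ (λ _ → colouredIn-update-≢) colouredIn-update-≡

    touched-update-⊆ : ∀ {i} → Touched σ' i → Touched σ i ⊎ i ≡ i₀
    touched-update-⊆ {i} t =
      [ inj₂ , (λ i≢i₀ → inj₁ (<-≤-trans t (colouredIn-update-≢ i≢i₀))) ]′ (Dec.toSum (i Fin.≟ i₀))

    touched-update : touched σ' ≤ suc (touched σ)
    touched-update = count-≤-suc (touched? σ') (touched? σ) i₀ touched-update-⊆

    touched-update-touched : Touched σ i₀ → touched σ' ≤ touched σ
    touched-update-touched t₀ = count-mono (touched? σ') (touched? σ) λ t →
      [ id , (λ { refl → t₀ }) ]′ (touched-update-⊆ t)

    used-update-≤ : used σ ≤ used σ'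
    used-update-≤ = count-mono (used? σ) (used? σ') (used-update {σ} {i₀ , j₀} free a)

    used-update-< : ¬ Used σ a → used σ < used σ'
    used-update-< unused =
      count-mono-< (used? σ) (used? σ') (used-update {σ} {i₀ , j₀} free a) unused (used-update-self σ _ a)

module BobStrategy (k : ℕ) (r : Fin k → ℕ) (c : ℕ) (4≤r : ∀ i → 4 ≤ r i) (2+c≤2k : 2 + c ≤ 2 * k)
  where
  open Game (CompleteMultipartite k r) c
  open GameProperties (CompleteMultipartite k r) c
  open Multipartite k r c

  AliceInv BobInv : Colouring → Set
  AliceInv σ = AliceBound (touched σ) (used σ) (coloured σ)
  BobInv   σ = BobBound (touched σ) (used σ) (coloured σ)

  first : ∀ i → Fin (r i)
  first i = fromℕ< (≤-trans (s≤s z≤n) (4≤r i))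

  too-few-colours : ∀ {σ} → (∀ i → Touched σ i) → ¬ 2 * touched σ ≤ suc (used σ)
  too-few-colours {σ} all-touched 2t≤1+u = <-irrefl refl (begin-strict
    suc c          <⟨ n<1+n _ ⟩
    2 + c          ≤⟨ 2+c≤2k ⟩
    2 * k          ≤⟨ *-monoʳ-≤ 2 (∀⇒n≤count (touched? σ) all-touched) ⟩
    2 * touched σ  ≤⟨ 2t≤1+u ⟩
    suc (used σ)   ≤⟨ s≤s (count≤n (used? σ)) ⟩
    suc c          ∎)
    where open ≤-Reasoning

  all-coloured⇒too-few-colours : ∀ {σ} → AllColoured σ → ¬ 2 * touched σ ≤ suc (used σ)
  all-coloured⇒too-few-colours {σ} all = too-few-colours λ i → coloured⇒touched {σ} (all (i , first i))

  full⇒4t≤n : ∀ {σ} → (∀ i j → Touched σ i → Is-just (σ (i , j))) → 4 * touched σ ≤ coloured σ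
  full⇒4t≤n {σ} full = begin
    4 * touched σ                      ≡⟨ *-distribˡ-sum 4 (𝟙 ∘ touched? σ) ⟩
    sum (λ i → 4 * 𝟙 (touched? σ i))   ≤⟨ sum-mono-≤ part ⟩
    coloured σ                         ∎
    where
    open ≤-Reasoning
    part : ∀ i → 4 * 𝟙 (touched? σ i) ≤ colouredIn σ i
    part i with touched? σ i
    ... | yes t = ≤-trans (4≤r i) (∀⇒n≤count (coloured? σ i) λ j → full i j t)
    ... | no _  = z≤n

  alice-move : ∀ {σ v a} → AliceInv σ → Legal σ v a → BobInv (update σ v a)
  alice-move {σ} {i , j} {a} inv (free , adjacent-free) with touched? σ i
  ... | yes t  = aliceBound-oldPart inv (<-≤-trans t (≤-sum (colouredIn σ) i))
                   (touched-update-touched free a t) (used-update-≤ free a) (coloured-update free a)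
  ... | no ¬t = aliceBound-newPart inv (touched-update free a)
                   (used-update-< free a unused) (coloured-update free a)
    where
    unused : ¬ Used σ a
    unused (w , σw≡a) = adjacent-free w (untouched⇒colours-elsewhere {σ} ¬t σw≡a) σw≡a

  new-part-reply : ∀ {σ a} → BobInv σ → ¬ Used σ a → 4 * touched σ ≤ coloured σ →
                   CanMoveInto AliceInv σ
  new-part-reply {σ} {a} inv unused 4t≤n with ∀⊎∃¬ (touched? σ)
  ... | inj₁ all-touched =
    contradiction (m<n⇒m≤1+n (4t≤n<2u⇒2t<u {touched σ} 4t≤n (proj₂ inv))) (too-few-colours all-touched)
  ... | inj₂ (i , ¬t) =
    (i , first i) , a , unused⇒legal free unused ,
    bobBound-newPart inv 4t≤n (touched-update free a) (used-update-< free a unused) (coloured-update free a)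
    where
    free : σ (i , first i) ≡ nothing
    free = untouched⇒free {σ} ¬t (first i)

  fresh-reply : ∀ {σ a} → BobInv σ → ¬ Used σ a → CanMoveInto AliceInv σ
  fresh-reply {σ} {a} inv unused
    with Fin.any? (λ i → touched? σ i ×-dec Fin.any? λ j → ¬? (coloured? σ i j))
  ... | yes (i , t , j , uncoloured) =
    (i , j) , a , unused⇒legal free unused ,
    bobBound-oldPart inv (touched-update-touched free a t) (used-update-< free a unused) (coloured-update free a)
    where
    free : σ (i , j) ≡ nothing
    free = ¬Is-just⇒≡nothing uncoloured
  ... | no no-gap = new-part-reply inv unused (full⇒4t≤n λ i j t →
    Dec.decidable-stable (coloured? σ i j) λ uncoloured → no-gap (i , t , j , uncoloured))

  all-used⇒blocked : ∀ {σ i} → (∀ a → Used σ a) → ¬ Touched σ i → Blocked σ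
  all-used⇒blocked {σ} {i} all-used ¬t = (i , first i) , untouched⇒free {σ} ¬t (first i) , λ a →
    let (w , σw≡a) = all-used a in w , untouched⇒colours-elsewhere {σ} ¬t σw≡a , σw≡a

  bob-reply : ∀ {σ} → BobInv σ → Blocked σ ⊎ CanMoveInto AliceInv σ
  bob-reply {σ} inv with ∀⊎∃¬ (used? σ)
  ... | inj₂ (a , unused) = inj₂ (fresh-reply inv unused)
  ... | inj₁ all-used with ∀⊎∃¬ (touched? σ)
  ...   | inj₁ all-touched = contradiction (proj₁ inv) (too-few-colours all-touched)
  ...   | inj₂ (i , ¬t)    = inj₁ (all-used⇒blocked all-used ¬t)

  open InvariantStrategy AliceInv BobInv
    (λ inv all → all-coloured⇒too-few-colours all (≤-trans (proj₁ inv) (n≤1+n _)))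
    (λ inv all → all-coloured⇒too-few-colours all (proj₁ inv))
    alice-move bob-reply

  alice-inv-empty : AliceInv empty
  alice-inv-empty = subst (λ t → 2 * t ≤ used empty) (sym touched-empty) z≤n , inj₁ coloured-empty

  no-winning-strategy : ¬ AliceHasWinningStrategy
  no-winning-strategy = alice-loses alice-inv-empty

corollary4 : (k : ℕ) (r : Fin k → ℕ) →
    (∀ i j → Data.Fin._≤_ i j → r j ≤ r i) →
    (∀ i → 4 ≤ r i) →
    GameChromatic≥ (CompleteMultipartite k r) (2 * k ∸ 1)
corollary4 k r _ 4≤r c c<2k∸1 =
  BobStrategy.no-winning-strategy k r c 4≤r (m<n∸1⇒2+m≤n (2 * k) c<2k∸1)
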